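{- Let $A\in\mathbb{Z}^{m\times d}$ with $\ker_{\mathbb{Z}}(A)\cap\mathbb{N}^d=\{0\}$, let $\mathcal{M}\subset\ker_{\mathbb{Z}}(A)$ be a finite set, and let $b\in\mathbb{N}A$. Then for all $u\in\mathbb{N}^d$, $$\partial^{\mathcal{M}}_u(\mathcal{F}_{A,b})\subseteq u+\bigcup_{j\in\mathrm{supp}(u)}\bigcup_{r=0}^{\mathcal{C}(\mathcal{M})}\{w\in\mathcal{F}_{A,b}: w_j=r\}.$$
   Context: $\mathbb{N}A$ is the affine semigroup generated by the columns of $A$; $\mathcal{F}_{A,b}=\{u\in\mathbb{N}^d:Au=b\}$. For $u\in\mathbb{N}^d$, the $u$-boundary is $\partial^{\mathcal{M}}_u(\mathcal{F}_{A,b})=\{v\in u+\mathcal{F}_{A,b}: \exists m\in\pm\mathcal{M},\ v+m\in\mathbb{N}^d\setminus(u+\mathcal{F}_{A,b})\}$. The complexity of a finite set $\mathcal{M}\subset\mathbb{Z}^d$ is $\mathcal{C}(\mathcal{M})=\max_{m\in\mathcal{M}}\|m\|_\infty$. -}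

module Defs where

open import Data.Nat as ℕ using (ℕ; zero; suc; _⊔_)
open import Data.Integer as ℤ using (ℤ; +_; ∣_∣)
open import Data.Fin using (Fin; zero; suc)
open import Data.List using (List; []; _∷_)
open import Data.List.Relation.Unary.Any using (Any)
open import Data.Product using (Σ; _×_; ∃)
open import Data.Sum using (_⊎_)
open import Relation.Binary.PropositionalEquality using (_≡_)
open import Relation.Nullary using (¬_)

finSum : ∀ {n} → (Fin n → ℤ) → ℤ
finSum {zero}  f = + 0
finSum {suc n} f = f zero ℤ.+ finSum (λ i → f (suc i))

finMax : ∀ {n} → (Fin n → ℕ) → ℕ
finMax {zero}  f = 0
finMax {suc n} f = f zero ⊔ finMax (λ i → f (suc i))

Mat : ℕ → ℕ → Set
Mat m d = Fin m → Fin d → ℤ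

_·_ : ∀ {m d} → Mat m d → (Fin d → ℤ) → Fin m → ℤ
(A · v) i = finSum (λ j → A i j ℤ.* v j)

ι : ∀ {d} → (Fin d → ℕ) → Fin d → ℤ
ι u j = + (u j)

InKer : ∀ {m d} → Mat m d → (Fin d → ℤ) → Set
InKer A v = ∀ i → (A · v) i ≡ + 0

PointedKer : ∀ {m d} → Mat m d → Set
PointedKer {d = d} A = (u : Fin d → ℕ) → InKer A (ι u) → ∀ j → u j ≡ 0

InSemigroup : ∀ {m d} → Mat m d → (Fin m → ℤ) → Set
InSemigroup {d = d} A b = Σ (Fin d → ℕ) λ c → ∀ i → (A · ι c) i ≡ b i

InFiber : ∀ {m d} → Mat m d → (Fin m → ℤ) → (Fin d → ℕ) → Set
InFiber A b w = ∀ i → (A · ι w) i ≡ b i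

InShiftedFiber : ∀ {m d} → Mat m d → (Fin m → ℤ) → (Fin d → ℕ) → (Fin d → ℕ) → Set
InShiftedFiber {d = d} A b u v =
  Σ (Fin d → ℕ) λ w → InFiber A b w × (∀ j → v j ≡ u j ℕ.+ w j)

InPlusMinus : ∀ {d} → List (Fin d → ℤ) → (Fin d → ℤ) → Set
InPlusMinus M m' = Any (λ m → (∀ j → m' j ≡ m j) ⊎ (∀ j → m' j ≡ ℤ.- m j)) M

InBoundary : ∀ {m d} → Mat m d → (Fin m → ℤ) → List (Fin d → ℤ)
           → (Fin d → ℕ) → (Fin d → ℕ) → Set
InBoundary {d = d} A b M u v =
  InShiftedFiber A b u v ×
  Σ (Fin d → ℤ) λ m' → InPlusMinus M m' ×
    Σ (Fin d → ℕ) λ x → (∀ j → ι x j ≡ + (v j) ℤ.+ m' j)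
                      × ¬ InShiftedFiber A b u x

normInf : ∀ {d} → (Fin d → ℤ) → ℕ
normInf v = finMax (λ j → ∣ v j ∣)

complexity : ∀ {d} → List (Fin d → ℤ) → ℕ
complexity []      = 0
complexity (m ∷ M) = normInf m ⊔ complexity M

module Submission where

-- Let v = u + w with w ∈ F_{A,b}, and let x = v + m' ∈ ℕ^d with m' ∈ ±M but
-- x ∉ u + F_{A,b}.  Every m' ∈ ±M lies in ker(A) and has ‖m'‖∞ ≤ C(M).
--   * If u ≤ x coordinatewise, then x - u = w + m' is a natural vector with
--     A(w + m') = b, so x ∈ u + F_{A,b}: impossible.
--   * Hence x_j < u_j for some j.  Then u_j ≠ 0, and from x_j = u_j + w_j + m'_j
--     we get w_j ≤ u_j + w_j - x_j = |m'_j| ≤ C(M).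

open import Defs
open import Data.Nat using (ℕ; _≤_; _+_)
open import Data.Integer using (ℤ)
open import Data.Fin using (Fin)
open import Data.List using (List)
open import Data.List.Relation.Unary.All using (All)
open import Data.Product using (Σ; _×_)
open import Relation.Binary.PropositionalEquality using (_≡_; _≢_)

open import Data.Nat using (zero; suc; _∸_; _<_; _≤?_)
open import Data.Nat.Properties as ℕ
  using (≤-trans; ≤-reflexive; m≤m⊔n; m≤n⊔m; m≤n+m; m+[n∸m]≡n; +-∸-comm; ≰⇒>; n≮0)
open import Data.Integer as ℤ using (+_; -_; ∣_∣; _⊖_)
  renaming (_+_ to _+ℤ_; _-_ to _-ℤ_; _*_ to _*ℤ_)
import Data.Integer.Properties as ℤ
open import Data.Integer.Tactic.RingSolver using (solve-∀)
open import Data.Fin.Properties using (all?; ¬∀⟶∃¬)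
open import Data.List using ([]; _∷_)
open import Data.List.Relation.Unary.All using ([]; _∷_)
open import Data.List.Relation.Unary.Any using (here; there)
open import Data.Product using (_,_)
open import Data.Sum using (inj₁; inj₂)
open import Data.Empty using (⊥-elim)
open import Relation.Nullary using (yes; no)
open import Relation.Binary.PropositionalEquality
  using (refl; sym; trans; cong; cong₂; subst; module ≡-Reasoning)

finSum-cong : ∀ {n} {f g : Fin n → ℤ} → (∀ j → f j ≡ g j) → finSum f ≡ finSum g
finSum-cong {zero}  e = refl
finSum-cong {suc n} e = cong₂ _+ℤ_ (e Fin.zero) (finSum-cong (λ i → e (Fin.suc i)))

interchange : ∀ a b c d → (a +ℤ b) +ℤ (c +ℤ d) ≡ (a +ℤ c) +ℤ (b +ℤ d)
interchange = solve-∀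

finSum-+ : ∀ {n} (f g : Fin n → ℤ) → finSum (λ j → f j +ℤ g j) ≡ finSum f +ℤ finSum g
finSum-+ {zero}  f g = refl
finSum-+ {suc n} f g =
  trans (cong (f Fin.zero +ℤ g Fin.zero +ℤ_) (finSum-+ (λ i → f (Fin.suc i)) (λ i → g (Fin.suc i))))
        (interchange (f Fin.zero) (g Fin.zero) _ _)

finSum-neg : ∀ {n} (f : Fin n → ℤ) → finSum (λ j → - f j) ≡ - finSum f
finSum-neg {zero}  f = refl
finSum-neg {suc n} f =
  trans (cong (- f Fin.zero +ℤ_) (finSum-neg (λ i → f (Fin.suc i))))
        (sym (ℤ.neg-distrib-+ (f Fin.zero) _))

·-cong : ∀ {m d} (A : Mat m d) {v v′ : Fin d → ℤ} → (∀ j → v j ≡ v′ j)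
       → ∀ i → (A · v) i ≡ (A · v′) i
·-cong A e i = finSum-cong (λ j → cong (A i j *ℤ_) (e j))

·-+ : ∀ {m d} (A : Mat m d) (v t : Fin d → ℤ)
    → ∀ i → (A · (λ j → v j +ℤ t j)) i ≡ (A · v) i +ℤ (A · t) i
·-+ A v t i =
  trans (finSum-cong (λ j → ℤ.*-distribˡ-+ (A i j) (v j) (t j)))
        (finSum-+ (λ j → A i j *ℤ v j) (λ j → A i j *ℤ t j))

·-neg : ∀ {m d} (A : Mat m d) (v : Fin d → ℤ)
      → ∀ i → (A · (λ j → - v j)) i ≡ - (A · v) i
·-neg A v i =
  trans (finSum-cong (λ j → sym (ℤ.neg-distribʳ-* (A i j) (v j))))
        (finSum-neg (λ j → A i j *ℤ v j))

fiber-translate : ∀ {m d} (A : Mat m d) (b : Fin m → ℤ) {w w′ : Fin d → ℕ} {t : Fin d → ℤ}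
                → InFiber A b w → InKer A t → (∀ j → ι w′ j ≡ ι w j +ℤ t j)
                → InFiber A b w′
fiber-translate A b {w} {w′} {t} w∈F t∈ker e i = begin
  (A · ι w′) i                        ≡⟨ ·-cong A e i ⟩
  (A · (λ j → ι w j +ℤ t j)) i        ≡⟨ ·-+ A (ι w) t i ⟩
  (A · ι w) i +ℤ (A · t) i            ≡⟨ cong₂ _+ℤ_ (w∈F i) (t∈ker i) ⟩
  b i +ℤ + 0                          ≡⟨ ℤ.+-identityʳ (b i) ⟩
  b i                                 ∎
  where open ≡-Reasoning

finMax-upper : ∀ {n} (f : Fin n → ℕ) j → f j ≤ finMax f
finMax-upper f Fin.zero    = m≤m⊔n _ _
finMax-upper f (Fin.suc j) = ≤-trans (finMax-upper (λ i → f (Fin.suc i)) j) (m≤n⊔m (f Fin.zero) _)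

head-bound : ∀ {d} (v : Fin d → ℤ) (M : List (Fin d → ℤ)) j → ∣ v j ∣ ≤ complexity (v ∷ M)
head-bound v M j = ≤-trans (finMax-upper (λ k → ∣ v k ∣) j) (m≤m⊔n (normInf v) (complexity M))

±M-kernel : ∀ {m d} (A : Mat m d) (M : List (Fin d → ℤ)) → All (InKer A) M
          → ∀ {m′} → InPlusMinus M m′ → InKer A m′
±M-kernel A (v ∷ M) (v∈ker ∷ _) (here (inj₁ e)) i = trans (·-cong A e i) (v∈ker i)
±M-kernel A (v ∷ M) (v∈ker ∷ _) (here (inj₂ e)) i =
  trans (·-cong A e i) (trans (·-neg A v i) (cong -_ (v∈ker i)))
±M-kernel A (v ∷ M) (_ ∷ M⊆ker) (there p) = ±M-kernel A M M⊆ker p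

±M-bounded : ∀ {d} (M : List (Fin d → ℤ)) {m′} → InPlusMinus M m′
           → ∀ j → ∣ m′ j ∣ ≤ complexity M
±M-bounded (v ∷ M) (here (inj₁ e)) j =
  ≤-trans (≤-reflexive (cong ∣_∣ (e j))) (head-bound v M j)
±M-bounded (v ∷ M) (here (inj₂ e)) j =
  ≤-trans (≤-reflexive (trans (cong ∣_∣ (e j)) (ℤ.∣-i∣≡∣i∣ (v j)))) (head-bound v M j)
±M-bounded (v ∷ M) (there p) j =
  ≤-trans (±M-bounded M p j) (m≤n⊔m (normInf v) (complexity M))

step-recovered : ∀ (x y : ℕ) (t : ℤ) → + x ≡ + y +ℤ t → t ≡ x ⊖ y
step-recovered x y t e = begin
  t                      ≡⟨ cancel (+ y) t ⟩
  (+ y +ℤ t) -ℤ + y      ≡⟨ cong (_-ℤ + y) (sym e) ⟩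
  + x -ℤ + y             ≡⟨ ℤ.m-n≡m⊖n x y ⟩
  x ⊖ y                  ∎
  where
  open ≡-Reasoning
  cancel : ∀ a s → s ≡ (a +ℤ s) -ℤ a
  cancel = solve-∀

excess-shift : ∀ {x u v w : ℕ} (t : ℤ) → u ≤ x → + x ≡ + v +ℤ t → v ≡ u + w
             → + (x ∸ u) ≡ + w +ℤ t
excess-shift {x} {u} {w = w} t u≤x x≡v+t refl = begin
  + (x ∸ u)                 ≡⟨ sym (ℤ.⊖-≥ u≤x) ⟩
  x ⊖ u                     ≡⟨ sym (ℤ.m-n≡m⊖n x u) ⟩
  + x -ℤ + u                ≡⟨ cong (_-ℤ + u) x≡v+t ⟩
  (+ (u + w) +ℤ t) -ℤ + u   ≡⟨ cong (λ s → (s +ℤ t) -ℤ + u) (ℤ.pos-+ u w) ⟩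
  ((+ u +ℤ + w) +ℤ t) -ℤ + u ≡⟨ drop (+ u) (+ w) t ⟩
  + w +ℤ t                  ∎
  where
  open ≡-Reasoning
  drop : ∀ a c s → ((a +ℤ c) +ℤ s) -ℤ a ≡ c +ℤ s
  drop = solve-∀

-- If x < u, the step t must undo all of w: w ≤ (u + w) - x = ∣ t ∣.
deficit-bound : ∀ {x u v w : ℕ} (t : ℤ) → x < u → + x ≡ + v +ℤ t → v ≡ u + w
              → w ≤ ∣ t ∣
deficit-bound {x} {u} {w = w} t x<u x≡v+t refl = begin
  w                   ≤⟨ m≤n+m w (u ∸ x) ⟩
  (u ∸ x) + w         ≡⟨ sym (+-∸-comm w x≤u) ⟩
  (u + w) ∸ x         ≡⟨ sym (ℤ.∣⊖∣-≤ (≤-trans x≤u (ℕ.m≤m+n u w))) ⟩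
  ∣ x ⊖ (u + w) ∣     ≡⟨ cong ∣_∣ (sym (step-recovered x (u + w) t x≡v+t)) ⟩
  ∣ t ∣               ∎
  where
  open ℕ.≤-Reasoning
  x≤u : x ≤ u
  x≤u = ℕ.<⇒≤ x<u

dominating-in-shifted-fiber : ∀ {m d} (A : Mat m d) (b : Fin m → ℤ) (u : Fin d → ℕ)
  {v x : Fin d → ℕ} {t : Fin d → ℤ}
  → InShiftedFiber A b u v → InKer A t → (∀ j → ι x j ≡ + v j +ℤ t j)
  → (∀ j → u j ≤ x j) → InShiftedFiber A b u x
dominating-in-shifted-fiber A b u {x = x} {t} (w , w∈F , v≡u+w) t∈ker x≡v+t u≤x =
  (λ j → x j ∸ u j) ,
  fiber-translate A b w∈F t∈ker
    (λ j → excess-shift (t j) (u≤x j) (x≡v+t j) (v≡u+w j)) ,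
  (λ j → sym (m+[n∸m]≡n (u≤x j)))

lemma3p13 : (m d : ℕ) (A : Mat m d) → PointedKer A
    → (M : List (Fin d → ℤ)) → All (InKer A) M
    → (b : Fin m → ℤ) → InSemigroup A b
    → (u v : Fin d → ℕ) → InBoundary A b M u v
    → Σ (Fin d → ℕ) λ w → InFiber A b w × (∀ k → v k ≡ u k + w k)
        × Σ (Fin d) λ j → (u j ≢ 0) × (w j ≤ complexity M)
lemma3p13 m d A _ M M⊆ker b _ u v
  (v∈u+F@(w , w∈F , v≡u+w) , m′ , m′∈±M , x , x≡v+m′ , x∉u+F)
  with all? (λ j → u j ≤? x j)
... | yes u≤x = ⊥-elim (x∉u+F
        (dominating-in-shifted-fiber A b u v∈u+F (±M-kernel A M M⊆ker m′∈±M) x≡v+m′ u≤x))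
... | no u≰x with ¬∀⟶∃¬ d _ (λ j → u j ≤? x j) u≰x
...   | j , uⱼ≰xⱼ = w , w∈F , v≡u+w , j , uⱼ≢0 , wⱼ≤C
  where
  xⱼ<uⱼ : x j < u j
  xⱼ<uⱼ = ≰⇒> uⱼ≰xⱼ
  uⱼ≢0 : u j ≢ 0
  uⱼ≢0 uⱼ≡0 = n≮0 (subst (x j <_) uⱼ≡0 xⱼ<uⱼ)
  wⱼ≤C : w j ≤ complexity M
  wⱼ≤C = ≤-trans
    (deficit-bound (m′ j) xⱼ<uⱼ (x≡v+m′ j) (v≡u+w j))
    (±M-bounded M m′∈±M j)
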